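{- Let $n\ge2$ and let $(r_i,s_i)$, $i=1,\dots,n$, be the signatures of the complex hermitian spaces $V_x^{(i)}$ described in the context. Then the cycles $C_0$ and $C_x$ have complementary codimension in $M$, i.e. $\operatorname{codim}C_0+\operatorname{codim}C_x=\dim_{\mathbb{C}}D$, equivalently $$\sum_{i=1}^n\big(s_i(n-r_i)+r_i(1-s_i)\big)=n,$$ if and only if either $(r_i,s_i)=(1,0)$ for all $i$, or $(r_i,s_i)=(n-1,1)$ for all $i$.
   Context: Setting: $F$ totally real of degree $n$ with embeddings $\lambda_1,\dots,\lambda_n$, $E_0$ imaginary quadratic, $E=FE_0$, $(V_0,Q_0)$ hermitian over $E_0$ of signature $(p,q)=(n,1)$, $(V,Q)=(V_0,Q_0)\otimes_{E_0}E$, so each $V^{(i)}=V\otimes_{F,\lambda_i}\mathbb{R}$ has signature $(n,1)$. $D$ is the product over $i$ of the spaces of negative lines in $V^{(i)}$, of complex dimension $npq=n^2$; $M=\Gamma\backslash D$ for an arithmetic group $\Gamma$. $C_0$ is the base change cycle, image of $\Gamma_0\backslash D_0\to M$ with $D_0$ diagonally embedded, of codimension $(n-1)pq=(n-1)n$. For a tuple $x$ of vectors of $V$ spanning a non-degenerate subspace $V'_x$, with $V_x=V_x'^{\perp}$ and $V_x^{(i)}=V_x\otimes_{F,\lambda_i}\mathbb{R}$ of signature $(r_i,s_i)$ (so $r_i+s_i=\dim_E V_x$ for all $i$, $0\le r_i\le n$, $0\le s_i\le 1$), the basic cycle $C_x$ has codimension $\sum_{i=1}^n(ps_i+qr_i-2r_is_i)=\sum_{i=1}^n(ns_i+r_i-2r_is_i)$.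 -}

module Defs where

open import Data.Nat using (ℕ; zero; suc; _+_; _*_; _∸_)
open import Data.Fin using (Fin; zero; suc)

∑ : (n : ℕ) → (Fin n → ℕ) → ℕ
∑ zero    f = 0
∑ (suc n) f = f zero + ∑ n (λ i → f (suc i))

-- Setting: F totally real of degree n, hermitian space of signature (p,q) = (n,1).
sigP : ℕ → ℕ
sigP n = n

sigQ : ℕ → ℕ
sigQ n = 1

dimD : ℕ → ℕ
dimD n = n * sigP n * sigQ n

codimC0 : ℕ → ℕ
codimC0 n = (n ∸ 1) * sigP n * sigQ n

-- codim C_x = Σ_i (p s_i + q r_i − 2 r_i s_i), where (r_i,s_i) is the signature of V_x^(i).
-- (The subtraction is exact under the standing constraints r_i ≤ p, s_i ≤ q = 1.)
codimCx : (n : ℕ) → (r s : Fin n → ℕ) → ℕ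
codimCx n r s = ∑ n (λ i → (sigP n * s i + sigQ n * r i) ∸ 2 * r i * s i)

{-# OPTIONS --safe #-}
module Submission where

open import Defs
open import Data.Nat using (ℕ; zero; suc; _+_; _*_; _∸_; _≤_; z≤n; s≤s; _≟_)
open import Data.Nat.Properties
open import Data.Fin using (Fin; zero; suc)
open import Data.Product using (_×_; _,_)
open import Data.Sum using (_⊎_; inj₁; inj₂; [_,_]′)
open import Data.Empty using (⊥; ⊥-elim)
open import Function using (id; _∘_)
open import Function.Bundles using (_⇔_; mk⇔; Equivalence)
open import Function.Properties.Equivalence using () renaming (trans to ⇔-trans)
open import Relation.Binary.PropositionalEquality
open import Relation.Nullary using (yes; no; contradiction)

-- Since codim C₀ = (n − 1)n and dim D = n², the equation says that the n summands tᵢ of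
-- codim C_x add up to n, where tᵢ = rᵢ if sᵢ = 0 and tᵢ = n − rᵢ if sᵢ = 1. If some tᵢ
-- vanishes then dim V_x ∈ {0, n + 1}, so every tⱼ vanishes and the sum is 0 ≠ n.
-- Otherwise every tᵢ ≥ 1, hence every tᵢ = 1, i.e. (rᵢ, sᵢ) ∈ {(1,0), (n−1,1)}; these
-- signatures have dimensions 1 and n, which differ as n ≥ 2, so only one of them occurs.

∑-const : ∀ m {f : Fin m → ℕ} {c} → (∀ i → f i ≡ c) → ∑ m f ≡ m * c
∑-const zero    f≡c = refl
∑-const (suc m) f≡c = cong₂ _+_ (f≡c zero) (∑-const m (f≡c ∘ suc))

∑-lowerBound : ∀ m {f : Fin m → ℕ} {c} → (∀ i → c ≤ f i) → m * c ≤ ∑ m f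
∑-lowerBound zero    c≤f = z≤n
∑-lowerBound (suc m) c≤f = +-mono-≤ (c≤f zero) (∑-lowerBound m (c≤f ∘ suc))

+-≤-tight : ∀ {a b c d} → a ≤ b → c ≤ d → b + d ≡ a + c → b ≡ a × d ≡ c
+-≤-tight {a} {b} {c} {d} a≤b c≤d b+d≡a+c = b≡a , +-cancelˡ-≡ b d c (trans b+d≡a+c (cong (_+ c) (sym b≡a)))
  where
  b≡a : b ≡ a
  b≡a = ≤-antisym (+-cancelʳ-≤ d b a (≤-trans (≤-reflexive b+d≡a+c) (+-monoʳ-≤ a c≤d))) a≤b

∑≡*⇒≡ : ∀ m {f : Fin m → ℕ} {c} → (∀ i → c ≤ f i) → ∑ m f ≡ m * c → ∀ i → f i ≡ c
∑≡*⇒≡ (suc m) c≤f ∑≡ with +-≤-tight (c≤f zero) (∑-lowerBound m (c≤f ∘ suc)) ∑≡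
... | f₀≡c , rest≡ = λ { zero → f₀≡c ; (suc i) → ∑≡*⇒≡ m (c≤f ∘ suc) rest≡ i }

∀⊎⇔⊎∀ : {I : Set} {P Q : I → Set} → I → (∀ i j → P i → Q j → ⊥)
      → (∀ i → P i ⊎ Q i) ⇔ ((∀ i → P i) ⊎ (∀ i → Q i))
∀⊎⇔⊎∀ {P = P} {Q} i₀ apart = mk⇔ to [ (λ p i → inj₁ (p i)) , (λ q i → inj₂ (q i)) ]′
  where
  to : (∀ i → P i ⊎ Q i) → (∀ i → P i) ⊎ (∀ i → Q i)
  to pq with pq i₀
  ... | inj₁ p₀ = inj₁ (λ i → [ id , (λ q → ⊥-elim (apart i₀ i p₀ q)) ]′ (pq i))
  ... | inj₂ q₀ = inj₂ (λ i → [ (λ p → ⊥-elim (apart i i₀ p q₀)) , id ]′ (pq i))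

∀-cong-⇔ : {I : Set} {A B : I → Set} → (∀ i → A i ⇔ B i) → (∀ i → A i) ⇔ (∀ i → B i)
∀-cong-⇔ A⇔B = mk⇔ (λ a i → Equivalence.to (A⇔B i) (a i)) (λ b i → Equivalence.from (A⇔B i) (b i))

dimD≡codimC0+n : ∀ m → dimD (suc m) ≡ codimC0 (suc m) + suc m
dimD≡codimC0+n m
  rewrite *-identityʳ (suc m * suc m) | *-identityʳ (m * suc m) = +-comm (suc m) (m * suc m)

codimC0+x≡dimD⇔x≡n : ∀ m {x} → (codimC0 (suc m) + x ≡ dimD (suc m)) ⇔ (x ≡ suc m)
codimC0+x≡dimD⇔x≡n m {x} = mk⇔
  (λ eq → +-cancelˡ-≡ (codimC0 (suc m)) x (suc m) (trans eq (dimD≡codimC0+n m)))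
  (λ x≡n → trans (cong (codimC0 (suc m) +_) x≡n) (sym (dimD≡codimC0+n m)))

codimTerm : ℕ → ℕ → ℕ → ℕ
codimTerm n r s = (sigP n * s + sigQ n * r) ∸ 2 * r * s

codimTerm-s≡0 : ∀ n r → codimTerm n r 0 ≡ r
codimTerm-s≡0 n r rewrite *-zeroʳ n | *-zeroʳ (2 * r) | +-identityʳ r = refl

codimTerm-s≡1 : ∀ n r → codimTerm n r 1 ≡ n ∸ r
codimTerm-s≡1 n r rewrite *-identityʳ n | *-identityʳ (2 * r) | +-identityʳ r | +-comm n r =
  [m+n]∸[m+o]≡n∸o r n r

codimTerm≡0⇔ : ∀ {n r s} → r ≤ n → s ≤ 1
             → (codimTerm n r s ≡ 0) ⇔ (r + s ≡ 0 ⊎ r + s ≡ suc n)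
codimTerm≡0⇔ {n} {r} r≤n z≤n rewrite codimTerm-s≡0 n r | +-identityʳ r = mk⇔ inj₁
  [ id , (λ r≡1+n → contradiction (≤-trans (≤-reflexive (sym r≡1+n)) r≤n) (n≮n n)) ]′
codimTerm≡0⇔ {n} {r} r≤n (s≤s z≤n) rewrite codimTerm-s≡1 n r | +-comm r 1 = mk⇔
  (λ n∸r≡0 → inj₂ (cong suc (≤-antisym r≤n (m∸n≡0⇒m≤n n∸r≡0))))
  [ (λ ()) , (λ r+1≡1+n → trans (cong (n ∸_) (suc-injective r+1≡1+n)) (n∸n≡0 n)) ]′

codimTerm≡1⇔ : ∀ {n r s} → 1 ≤ n → r ≤ n → s ≤ 1
             → (codimTerm n r s ≡ 1) ⇔ ((r ≡ 1 × s ≡ 0) ⊎ (r ≡ n ∸ 1 × s ≡ 1))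
codimTerm≡1⇔ {n} {r} _ _ z≤n rewrite codimTerm-s≡0 n r = mk⇔
  (λ r≡1 → inj₁ (r≡1 , refl))
  [ (λ { (r≡1 , _) → r≡1 }) , (λ { (_ , ()) }) ]′
codimTerm≡1⇔ {n} {r} 1≤n r≤n (s≤s z≤n) rewrite codimTerm-s≡1 n r = mk⇔
  (λ n∸r≡1 → inj₂ (trans (sym (m∸[m∸n]≡n r≤n)) (cong (n ∸_) n∸r≡1) , refl))
  [ (λ { (_ , ()) }) , (λ { (r≡n∸1 , _) → trans (cong (n ∸_) r≡n∸1) (m∸[m∸n]≡n 1≤n) }) ]′

module _ {m : ℕ} (r s : Fin (suc m) → ℕ)
         (r≤n : ∀ i → r i ≤ suc m) (s≤1 : ∀ i → s i ≤ 1)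
         (equidim : ∀ i j → r i + s i ≡ r j + s j) where

  private
    t : Fin (suc m) → ℕ
    t i = codimTerm (suc m) (r i) (s i)

  codimTerm≡0-spreads : ∀ i j → t i ≡ 0 → t j ≡ 0
  codimTerm≡0-spreads i j tᵢ≡0 =
    Equivalence.from (codimTerm≡0⇔ (r≤n j) (s≤1 j))
      (subst (λ d → d ≡ 0 ⊎ d ≡ suc (suc m)) (equidim i j)
        (Equivalence.to (codimTerm≡0⇔ (r≤n i) (s≤1 i)) tᵢ≡0))

  ∑codimTerm≡n⇔all≡1 : (∑ (suc m) t ≡ suc m) ⇔ (∀ i → t i ≡ 1)
  ∑codimTerm≡n⇔all≡1 = mk⇔ all≡1 (λ t≡1 → trans (∑-const (suc m) t≡1) (*-identityʳ (suc m)))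
    where
    all≡1 : ∑ (suc m) t ≡ suc m → ∀ i → t i ≡ 1
    all≡1 ∑≡n with t zero ≟ 0
    ... | yes t₀≡0 with () ← trans (sym ∑≡n)
                               (trans (∑-const (suc m) (λ i → codimTerm≡0-spreads zero i t₀≡0)) (*-zeroʳ m))
    ... | no t₀≢0 = ∑≡*⇒≡ (suc m) (λ i → n≢0⇒n>0 (t₀≢0 ∘ codimTerm≡0-spreads i zero))
                      (trans ∑≡n (sym (*-identityʳ (suc m))))

mainTheorem3 : (n : ℕ) → 2 ≤ n → (r s : Fin n → ℕ)
    → (∀ i → r i ≤ n) → (∀ i → s i ≤ 1)
    → (∀ i j → r i + s i ≡ r j + s j)
    → (codimC0 n + codimCx n r s ≡ dimD n)
      ⇔ ((∀ i → (r i ≡ 1) × (s i ≡ 0)) ⊎ (∀ i → (r i ≡ n ∸ 1) × (s i ≡ 1)))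
mainTheorem3 (suc zero) (s≤s ()) _ _ _ _ _
mainTheorem3 (suc (suc k)) _ r s r≤n s≤1 equidim =
  ⇔-trans (codimC0+x≡dimD⇔x≡n (suc k))
  (⇔-trans (∑codimTerm≡n⇔all≡1 r s r≤n s≤1 equidim)
  (⇔-trans (∀-cong-⇔ (λ i → codimTerm≡1⇔ (s≤s z≤n) (r≤n i) (s≤1 i)))
           (∀⊎⇔⊎∀ zero dimensions-differ)))
  where
  dimensions-differ : ∀ i j → (r i ≡ 1) × (s i ≡ 0) → (r j ≡ suc k) × (s j ≡ 1) → ⊥
  dimensions-differ i j (rᵢ≡1 , sᵢ≡0) (rⱼ≡1+k , sⱼ≡1)
    with () ← trans (sym (cong₂ _+_ rᵢ≡1 sᵢ≡0))
                (trans (equidim i j) (trans (cong₂ _+_ rⱼ≡1+k sⱼ≡1) (+-comm (suc k) 1)))
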